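{- Let $b,c$ be integers with $n=b^2+c^2$ prime and $\{4,4\}_{(b,c)}$ chiral, let $t$ be an integer with $2\le t\le n-2$, $t^2\equiv-1\pmod n$, $t\equiv 0$ or $3\pmod 4$, and let $\sigma_1,\sigma_2,\tau$ be the permutations of $V=\{1,\dots,4n\}\cup\{1',\dots,(4n)'\}$ given by (unprimed entries modulo $4n$ in $\{1,\dots,4n\}$) $\sigma_1=\prod_{i=0}^{n-1}(4i+1,4i+2,4i+3,4i+4)$, $\sigma_2=\prod_{i=0}^{n-1}(4i+1,4i+4t+2,4i+4t+7,4i+8)$, both acting on primed points by $(j')\sigma=(j\sigma)'$, and $\tau=(5,(4t+1)')(6,(4t+4)')(7,(4t+3)')(8,(4t+2)')(4t+1,5')(4t+2,8')(4t+3,7')(4t+4,6')\prod_{0\le i\le n-1,\ i\ne1,t}(4i+1,(4i+1)')(4i+2,(4i+4)')(4i+3,(4i+3)')(4i+4,(4i+2)')$. Let $\Gamma=\langle\sigma_1,\sigma_2,\tau\rangle$ (the automorphism group of the chiral $4$-polytope $\mathcal P$ with abstract rotations $\sigma_1,\sigma_2,\sigma_2^{ -1}\tau$). For $k\in\{1,2,3,4\}$ let class $k$ be $\{4i+k:0\le i\le n-1\}$ and class $k'$ be $\{(4i+k)':0\le i\le n-1\}$, and let $\Lambda$ be the subgroup of $\Gamma$ stabilizing each of these eight classes setwise. Then $\Gamma\cong\Lambda\rtimes D_4$, where $D_4$ is the dihedral group of order $8$.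
   Context: $\{4,4\}_{(b,c)}$ is the toroidal quotient of the square tessellation of the plane by the translations along $(b,c)$ and $(-c,b)$. -}

module Defs where

open import Data.Nat using (ℕ; zero; suc; _+_; _*_; _∸_; NonZero; _≡ᵇ_; _%_)
open import Data.Nat.DivMod using (_mod_)
open import Data.Integer as ℤ using (ℤ; ∣_∣)
open import Data.Fin as Fin using (Fin; toℕ)
import Data.Fin.Properties as FinP
open import Data.Nat.Properties using (m*n≢0)
open import Data.Bool using (Bool; true; false; not; _xor_; _∧_; if_then_else_)
import Data.Bool.Properties as BoolP
open import Data.Product using (Σ; Σ-syntax; _×_; _,_)
open import Data.Product.Properties using (≡-dec)
open import Data.List using (List; []; _∷_; _++_; map; concatMap; upTo; filterᵇ; reverse; foldl)
open import Relation.Nullary using (¬_; yes; no)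
open import Relation.Binary.PropositionalEquality using (_≡_; _≢_)

-- Chirality of the toroidal map {4,4}_(b,c).
-- Standard criterion (Coxeter–Moser): {4,4}_(b,c) is chiral iff
-- b c (b - c) ≠ 0 (for b, c ≥ 0); for signed b, c: b ≠ 0, c ≠ 0, |b| ≠ |c|.

Chiral44 : ℤ → ℤ → Set
Chiral44 b c = (b ≢ ℤ.0ℤ) × (c ≢ ℤ.0ℤ) × (∣ b ∣ ≢ ∣ c ∣)

-- The dihedral group D₄ of order 8: elements r^k s^e (k ∈ Z/4, e ∈ {0,1}),
-- with r⁴ = s² = 1, s r s = r⁻¹.

D4 : Set
D4 = Fin 4 × Bool

_·D_ : D4 → D4 → D4
(a , x) ·D (b , y) =
  ((toℕ a + (if x then 4 ∸ toℕ b else toℕ b)) mod 4 , x xor y)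

eD : D4
eD = (Fin.zero , false)

-- V = {1,…,4n} ∪ {1',…,(4n)'} is encoded as Fin (4n) × Bool:
-- the label L (taken modulo 4n) is stored as L mod 4n (so label 4n ↦ 0),
-- and the Bool records whether the point is primed (true) or not (false).

V : ℕ → Set
V n = Fin (4 * n) × Bool

module Setup (n : ℕ) {{nz : NonZero n}} (t : ℕ) where

  instance
    nz4 : NonZero (4 * n)
    nz4 = m*n≢0 4 n

  pt : ℕ → V n
  pt L = (L mod (4 * n) , false)

  pt' : ℕ → V n
  pt' L = (L mod (4 * n) , true)

  _≟V_ : (x y : V n) → Relation.Nullary.Dec (x ≡ y)
  _≟V_ = ≡-dec FinP._≟_ BoolP._≟_

  Cycle : Set
  Cycle = List (V n)

  private
    go : V n → V n → Cycle → V n → V n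
    go first a [] x with x ≟V a
    ... | yes _ = first
    ... | no  _ = x
    go first a (b ∷ rest) x with x ≟V a
    ... | yes _ = b
    ... | no  _ = go first b rest x

  applyCycle : Cycle → V n → V n
  applyCycle [] x = x
  applyCycle (a ∷ rest) x = go a a rest x

  -- A product of cycles c₁ c₂ … c_k, acting on the right as in the paper:
  -- x (c₁ c₂ … c_k) = (…((x c₁) c₂)…) c_k.
  applyProd : List Cycle → V n → V n
  applyProd cs x = foldl (λ y c → applyCycle c y) x cs

  invProd : List Cycle → List Cycle
  invProd cs = reverse (map reverse cs)

  idx : List ℕ
  idx = upTo n

  σ₁ : List Cycle
  σ₁ = concatMap (λ i →
         (pt (4 * i + 1) ∷ pt (4 * i + 2) ∷ pt (4 * i + 3) ∷ pt (4 * i + 4) ∷ []) ∷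
         (pt' (4 * i + 1) ∷ pt' (4 * i + 2) ∷ pt' (4 * i + 3) ∷ pt' (4 * i + 4) ∷ []) ∷ [])
       idx

  σ₂ : List Cycle
  σ₂ = concatMap (λ i →
         (pt (4 * i + 1) ∷ pt (4 * i + 4 * t + 2) ∷ pt (4 * i + 4 * t + 7) ∷ pt (4 * i + 8) ∷ []) ∷
         (pt' (4 * i + 1) ∷ pt' (4 * i + 4 * t + 2) ∷ pt' (4 * i + 4 * t + 7) ∷ pt' (4 * i + 8) ∷ []) ∷ [])
       idx

  tr : V n → V n → Cycle
  tr a b = a ∷ b ∷ []

  τ : List Cycle
  τ = tr (pt 5) (pt' (4 * t + 1)) ∷ tr (pt 6) (pt' (4 * t + 4)) ∷
      tr (pt 7) (pt' (4 * t + 3)) ∷ tr (pt 8) (pt' (4 * t + 2)) ∷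
      tr (pt (4 * t + 1)) (pt' 5) ∷ tr (pt (4 * t + 2)) (pt' 8) ∷
      tr (pt (4 * t + 3)) (pt' 7) ∷ tr (pt (4 * t + 4)) (pt' 6) ∷
      concatMap (λ i →
         tr (pt (4 * i + 1)) (pt' (4 * i + 1)) ∷ tr (pt (4 * i + 2)) (pt' (4 * i + 4)) ∷
         tr (pt (4 * i + 3)) (pt' (4 * i + 3)) ∷ tr (pt (4 * i + 4)) (pt' (4 * i + 2)) ∷ [])
       (filterᵇ (λ i → not (i ≡ᵇ 1) ∧ not (i ≡ᵇ t)) idx)

  gen : Fin 3 → List Cycle
  gen Fin.zero = σ₁
  gen (Fin.suc Fin.zero) = σ₂
  gen (Fin.suc (Fin.suc Fin.zero)) = τ

  -- Elements of Γ = ⟨σ₁, σ₂, τ⟩ are represented by words in the generators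
  -- and their inverses (letter (g , true) = g⁻¹); the product w₁ w₂ is
  -- concatenation (right actions: first w₁, then w₂).
  Word : Set
  Word = List (Fin 3 × Bool)

  letter : Fin 3 × Bool → V n → V n
  letter (g , false) = applyProd (gen g)
  letter (g , true)  = applyProd (invProd (gen g))

  act : Word → V n → V n
  act w x = foldl (λ y l → letter l y) x w

  invW : Word → Word
  invW w = reverse (map (λ { (g , e) → (g , not e) }) w)

  _≈_ : Word → Word → Set
  w₁ ≈ w₂ = ∀ x → act w₁ x ≡ act w₂ x

  cls : V n → ℕ × Bool
  cls (j , p) = (toℕ j % 4 , p)

  InΛ : Word → Set
  InΛ w = ∀ x → cls (act w x) ≡ cls x

  -- Γ ≅ Λ ⋊ D₄ (internal semidirect product): Λ is normal in Γ and has a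
  -- complement in Γ isomorphic to D₄.
  SemidirectΛD4 : Set
  SemidirectΛD4 =
    (∀ g l → InΛ l → InΛ (invW g ++ l ++ g)) ×
    Σ[ φ ∈ (D4 → Word) ]
      ((∀ d e → φ (d ·D e) ≈ (φ d ++ φ e)) ×
       (∀ d e → φ d ≈ φ e → d ≡ e) ×
       (∀ d → InΛ (φ d) → d ≡ eD) ×
       (∀ g → Σ[ l ∈ Word ] Σ[ d ∈ D4 ] (InΛ l × (g ≈ (l ++ φ d)))))

module Submission where

-- Let κ : V → D₄ name the class of a point by an element of D₄
-- (the eight classes correspond bijectively to the eight elements).  The
-- generators translate classes uniformly:
--   κ (x σ₁) = κ x · r,   κ (x σ₂) = κ x · r,   κ (x τ) = κ x · s.
-- Consequently a word w moves every class by one element ∂w ∈ D₄, so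
-- w ↦ ∂w is a homomorphism Γ → D₄ with kernel Λ, and Λ is normal.  Moreover
-- σ₁ and τ satisfy the defining relations σ₁⁴ = τ² = 1, σ₁ τ = τ σ₁³ of D₄,
-- so r^a s^e ↦ σ₁^a τ^e is a homomorphism D₄ → Γ splitting ∂: its image is
-- a complement of Λ.

open import Defs
open import Data.Nat using (ℕ; _+_; _*_; _∸_; _≤_; _%_)
open import Data.Nat.Divisibility using (_∣_)
open import Data.Nat.Primality using (Prime; prime⇒nonZero)
open import Data.Integer as ℤ using (ℤ)
open import Data.Sum using (_⊎_)
open import Relation.Binary.PropositionalEquality using (_≡_)

open import Data.Nat using (zero; suc; _<_; NonZero; _/_; _≡ᵇ_; z≤n; s≤s)
open import Data.Nat.DivMod using (_mod_; m≡m%n+[m/n]*n; [m+kn]%n≡m%n; m%n<n; m<n⇒m%n≡m; m∣n⇒o%n%m≡o%m; %-distribˡ-+; m%n%n≡m%n; m<n*o⇒m/o<n)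
open import Data.Nat.Divisibility using (divides)
import Data.Nat.Properties as NP
open import Data.Nat.Tactic.RingSolver using (solve-∀)
open import Data.Fin as Fin using (Fin; toℕ)
import Data.Fin.Properties as FinP
open import Data.Bool using (Bool; true; false; not; _∧_; T)
import Data.Bool.Properties as BoolP
open import Data.Product using (Σ-syntax; _×_; _,_; proj₁; proj₂; uncurry)
open import Data.Product.Properties using (≡-dec)
open import Data.Sum using (inj₁; inj₂)
open import Data.Empty using (⊥; ⊥-elim)
open import Data.Unit using (tt)
open import Data.List using (List; []; _∷_; _++_; map; concat; concatMap; upTo; filterᵇ; reverse; foldl; replicate; tabulate; [_])
import Data.List.Properties as LP
open import Data.List.Relation.Unary.Any using (Any; here; there)
import Data.List.Relation.Unary.Any.Properties as AnyP
open import Data.List.Relation.Unary.All using (All; []; _∷_)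
import Data.List.Relation.Unary.All as All
import Data.List.Relation.Unary.All.Properties as AllP
open import Data.List.Relation.Unary.AllPairs using (AllPairs; []; _∷_)
import Data.List.Relation.Unary.AllPairs as AP
import Data.List.Relation.Unary.AllPairs.Properties as APP
open import Data.List.Membership.Propositional using (_∈_; find; lose)
import Data.List.Membership.Propositional.Properties as MP
open import Relation.Nullary using (¬_; Dec; yes; no)
open import Relation.Nullary.Decidable using (toWitness; map′; ¬?; _×-dec_; _→-dec_)
open import Relation.Nullary.Decidable.Core using (T?)
open import Relation.Binary.PropositionalEquality using (refl; sym; trans; cong; cong₂; subst; _≢_; ≢-sym; module ≡-Reasoning)

_≟D_ : (d e : D4) → Dec (d ≡ e)
_≟D_ = ≡-dec FinP._≟_ BoolP._≟_

-- Predicates on Bool and on Fin m × Bool are decided by checking each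
-- instance; every identity about D₄ used below is verified this way.
allBool? : {P : Bool → Set} → (∀ b → Dec (P b)) → Dec (∀ b → P b)
allBool? P? = map′ (λ h → λ { false → proj₁ h ; true → proj₂ h })
                   (λ h → h false , h true) (P? false ×-dec P? true)

all×Bool? : ∀ {m} {P : Fin m × Bool → Set} → (∀ x → Dec (P x)) → Dec (∀ x → P x)
all×Bool? P? = map′ (λ h → λ { (a , e) → h a e }) (λ h a e → h (a , e))
                    (FinP.all? λ a → allBool? λ e → P? (a , e))

r s : D4
r = (Fin.suc Fin.zero , false)
s = (Fin.zero , true)

invD : D4 → D4
invD (a , false) = ((4 ∸ toℕ a) mod 4 , false)
invD (a , true) = (a , true)

·D-assoc : ∀ a b c → (a ·D b) ·D c ≡ a ·D (b ·D c)
·D-assoc = toWitness {a? = all×Bool? λ a → all×Bool? λ b → all×Bool? λ c →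
  ((a ·D b) ·D c) ≟D (a ·D (b ·D c))} _

·D-identityˡ : ∀ d → eD ·D d ≡ d
·D-identityˡ = toWitness {a? = all×Bool? λ d → (eD ·D d) ≟D d} _

·D-identityʳ : ∀ d → d ·D eD ≡ d
·D-identityʳ = toWitness {a? = all×Bool? λ d → (d ·D eD) ≟D d} _

·D-inverseˡ : ∀ d → invD d ·D d ≡ eD
·D-inverseˡ = toWitness {a? = all×Bool? λ d → (invD d ·D d) ≟D eD} _

·D-cancelʳ : ∀ c d → (c ·D d) ·D invD d ≡ c
·D-cancelʳ = toWitness {a? = all×Bool? λ c → all×Bool? λ d → ((c ·D d) ·D invD d) ≟D c} _

·D-cancelʳ⁻ : ∀ c d → (c ·D invD d) ·D d ≡ c
·D-cancelʳ⁻ = toWitness {a? = all×Bool? λ c → all×Bool? λ d → ((c ·D invD d) ·D d) ≟D c} _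

-- r has order exactly 4 and no power r, r², r³, nor s, fixes any element
-- under right multiplication; this is what separates the points of a cycle.
r-order4 : ∀ d → (((d ·D r) ·D r) ·D r) ·D r ≡ d
r-order4 = toWitness {a? = all×Bool? λ d → ((((d ·D r) ·D r) ·D r) ·D r) ≟D d} _

r¹-free : ∀ d → d ·D r ≢ d
r¹-free = toWitness {a? = all×Bool? λ d → ¬? ((d ·D r) ≟D d)} _

r²-free : ∀ d → (d ·D r) ·D r ≢ d
r²-free = toWitness {a? = all×Bool? λ d → ¬? (((d ·D r) ·D r) ≟D d)} _

r³-free : ∀ d → ((d ·D r) ·D r) ·D r ≢ d
r³-free = toWitness {a? = all×Bool? λ d → ¬? ((((d ·D r) ·D r) ·D r) ≟D d)} _

s-free : ∀ d → d ·D s ≢ d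
s-free = toWitness {a? = all×Bool? λ d → ¬? ((d ·D s) ≟D d)} _

rotation-mod4 : ∀ (a b : Fin 4) → (toℕ a + (4 ∸ toℕ b)) % 4 ≡ (toℕ a + toℕ b * 3) % 4
rotation-mod4 = toWitness {a? = FinP.all? λ a → FinP.all? λ b →
  ((toℕ a + (4 ∸ toℕ b)) % 4) NP.≟ ((toℕ a + toℕ b * 3) % 4)} _

-- Classes as elements of D₄.  classD k p names the class of labels ≡ k
-- (mod 4), primed iff p: the classes 1, 2, 3, 4 go to 1, r, r², r³ and
-- 1', 2', 3', 4' to s, r³s, r²s, rs.

classD : ℕ → Bool → D4
classD 0 false = (Fin.suc (Fin.suc (Fin.suc Fin.zero)) , false)
classD 1 false = (Fin.zero , false)
classD 2 false = (Fin.suc Fin.zero , false)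
classD 3 false = (Fin.suc (Fin.suc Fin.zero) , false)
classD 0 true = (Fin.suc Fin.zero , true)
classD 1 true = (Fin.zero , true)
classD 2 true = (Fin.suc (Fin.suc (Fin.suc Fin.zero)) , true)
classD 3 true = (Fin.suc (Fin.suc Fin.zero) , true)
classD _ _ = eD

classD⁻¹ : D4 → ℕ × Bool
classD⁻¹ (Fin.suc (Fin.suc (Fin.suc Fin.zero)) , false) = (0 , false)
classD⁻¹ (Fin.zero , false) = (1 , false)
classD⁻¹ (Fin.suc Fin.zero , false) = (2 , false)
classD⁻¹ (Fin.suc (Fin.suc Fin.zero) , false) = (3 , false)
classD⁻¹ (Fin.suc Fin.zero , true) = (0 , true)
classD⁻¹ (Fin.zero , true) = (1 , true)
classD⁻¹ (Fin.suc (Fin.suc (Fin.suc Fin.zero)) , true) = (2 , true)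
classD⁻¹ (Fin.suc (Fin.suc Fin.zero) , true) = (3 , true)

classD-retraction : ∀ k p → k < 4 → classD⁻¹ (classD k p) ≡ (k , p)
classD-retraction 0 false _ = refl
classD-retraction 1 false _ = refl
classD-retraction 2 false _ = refl
classD-retraction 3 false _ = refl
classD-retraction 0 true _ = refl
classD-retraction 1 true _ = refl
classD-retraction 2 true _ = refl
classD-retraction 3 true _ = refl
classD-retraction (suc (suc (suc (suc k)))) p (s≤s (s≤s (s≤s (s≤s ()))))

-- Positions inside a block of four labels 4i+1, …, 4i+4: position k carries
-- the label 4i + (k+1).  next is the cyclic successor, mirror is k ↦ −k,
-- the relabelling performed by τ (4i+1, 4i+2, 4i+3, 4i+4 ↦ 1', 4', 3', 2').

next mirror : Fin 4 → Fin 4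
next Fin.zero = Fin.suc Fin.zero
next (Fin.suc Fin.zero) = Fin.suc (Fin.suc Fin.zero)
next (Fin.suc (Fin.suc Fin.zero)) = Fin.suc (Fin.suc (Fin.suc Fin.zero))
next (Fin.suc (Fin.suc (Fin.suc Fin.zero))) = Fin.zero
mirror Fin.zero = Fin.zero
mirror (Fin.suc Fin.zero) = Fin.suc (Fin.suc (Fin.suc Fin.zero))
mirror (Fin.suc (Fin.suc Fin.zero)) = Fin.suc (Fin.suc Fin.zero)
mirror (Fin.suc (Fin.suc (Fin.suc Fin.zero))) = Fin.suc Fin.zero

res : Fin 4 → ℕ
res k = suc (toℕ k) % 4

next-order4 : ∀ k → next (next (next (next k))) ≡ k
next-order4 = toWitness {a? = FinP.all? λ k → next (next (next (next k))) FinP.≟ k} _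

mirror-involutive : ∀ k → mirror (mirror k) ≡ k
mirror-involutive = toWitness {a? = FinP.all? λ k → mirror (mirror k) FinP.≟ k} _

next-mirror : ∀ k → next (mirror k) ≡ mirror (next (next (next k)))
next-mirror = toWitness {a? = FinP.all? λ k → next (mirror k) FinP.≟ mirror (next (next (next k)))} _

res-injective : ∀ k k' → res k ≡ res k' → k ≡ k'
res-injective = toWitness {a? = FinP.all? λ k → FinP.all? λ k' →
  (res k NP.≟ res k') →-dec (k FinP.≟ k')} _

res-surjective : ∀ m → m < 4 → Σ[ k ∈ Fin 4 ] res k ≡ m
res-surjective 0 _ = Fin.suc (Fin.suc (Fin.suc Fin.zero)) , refl
res-surjective 1 _ = Fin.zero , refl
res-surjective 2 _ = Fin.suc Fin.zero , refl
res-surjective 3 _ = Fin.suc (Fin.suc Fin.zero) , refl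
res-surjective (suc (suc (suc (suc m)))) (s≤s (s≤s (s≤s (s≤s ()))))

classD-next : ∀ k p → classD (res (next k)) p ≡ classD (res k) p ·D r
classD-next = toWitness {a? = FinP.all? λ k → allBool? λ p →
  classD (res (next k)) p ≟D (classD (res k) p ·D r)} _

classD-mirror : ∀ k p → classD (res (mirror k)) (not p) ≡ classD (res k) p ·D s
classD-mirror = toWitness {a? = FinP.all? λ k → allBool? λ p →
  classD (res (mirror k)) (not p) ≟D (classD (res k) p ·D s)} _

genD : Fin 3 → D4
genD Fin.zero = r
genD (Fin.suc Fin.zero) = r
genD (Fin.suc (Fin.suc Fin.zero)) = s

letterD : Fin 3 × Bool → D4
letterD (g , false) = genD g
letterD (g , true) = invD (genD g)

flipL : Fin 3 × Bool → Fin 3 × Bool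
flipL (g , e) = (g , not e)

infixl 20 _·W_
_·W_ : D4 → List (Fin 3 × Bool) → D4
c ·W w = foldl (λ d ℓ → d ·D letterD ℓ) c w

·W-++ : ∀ c u v → c ·W (u ++ v) ≡ (c ·W u) ·W v
·W-++ c u v = LP.foldl-++ _ c u v

·W-factor : ∀ c w → c ·W w ≡ c ·D (eD ·W w)
·W-factor c [] = sym (·D-identityʳ c)
·W-factor c (ℓ ∷ w) = begin
    (c ·D letterD ℓ) ·W w            ≡⟨ ·W-factor (c ·D letterD ℓ) w ⟩
    (c ·D letterD ℓ) ·D (eD ·W w)    ≡⟨ ·D-assoc c (letterD ℓ) (eD ·W w) ⟩
    c ·D (letterD ℓ ·D (eD ·W w))    ≡⟨ cong (c ·D_) (sym (·W-factor (letterD ℓ) w)) ⟩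
    c ·D (letterD ℓ ·W w)            ≡⟨ cong (λ z → c ·D (z ·W w)) (sym (·D-identityˡ (letterD ℓ))) ⟩
    c ·D ((eD ·D letterD ℓ) ·W w)    ∎
  where open ≡-Reasoning

letterD-cancel : ∀ c ℓ → (c ·D letterD (flipL ℓ)) ·D letterD ℓ ≡ c
letterD-cancel c (g , false) = ·D-cancelʳ⁻ c (genD g)
letterD-cancel c (g , true) = ·D-cancelʳ c (genD g)

σL τL : Fin 3 × Bool
σL = (Fin.zero , false)
τL = (Fin.suc (Fin.suc Fin.zero) , false)

normalWord : D4 → List (Fin 3 × Bool)
normalWord (a , false) = replicate (toℕ a) σL
normalWord (a , true) = replicate (toℕ a) σL ++ [ τL ]

normalWord-image : ∀ d → eD ·W normalWord d ≡ d
normalWord-image = toWitness {a? = all×Bool? λ d → (eD ·W normalWord d) ≟D d} _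

module Development (n : ℕ) {{nz : NonZero n}} (t : ℕ) where
  open Setup n t
  open import Data.List.Membership.DecPropositional _≟V_ using (_∈?_)

  κ : V n → D4
  κ y = uncurry classD (cls y)

  κ-injective : ∀ a b → κ a ≡ κ b → cls a ≡ cls b
  κ-injective (i , p) (j , q) eq = begin
      (toℕ i % 4 , p)                ≡⟨ sym (classD-retraction (toℕ i % 4) p (m%n<n (toℕ i) 4)) ⟩
      classD⁻¹ (classD (toℕ i % 4) p) ≡⟨ cong classD⁻¹ eq ⟩
      classD⁻¹ (classD (toℕ j % 4) q) ≡⟨ classD-retraction (toℕ j % 4) q (m%n<n (toℕ j) 4) ⟩
      (toℕ j % 4 , q)                ∎
    where open ≡-Reasoning

  act-++ : ∀ u v y → act (u ++ v) y ≡ act v (act u y)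
  act-++ u v y = LP.foldl-++ _ y u v

  ·W-invW : ∀ c w → (c ·W invW w) ·W w ≡ c
  ·W-invW c [] = refl
  ·W-invW c (ℓ ∷ w) = begin
      (c ·W invW (ℓ ∷ w)) ·W (ℓ ∷ w)                          ≡⟨ cong (λ u → (c ·W u) ·W (ℓ ∷ w)) invW-∷ ⟩
      (c ·W (invW w ++ [ flipL ℓ ])) ·W (ℓ ∷ w)               ≡⟨ cong (_·W (ℓ ∷ w)) (·W-++ c (invW w) _) ⟩
      (((c ·W invW w) ·D letterD (flipL ℓ)) ·D letterD ℓ) ·W w ≡⟨ cong (_·W w) (letterD-cancel _ ℓ) ⟩
      (c ·W invW w) ·W w                                      ≡⟨ ·W-invW c w ⟩
      c                                                       ∎
    where
    open ≡-Reasoning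
    invW-∷ : invW (ℓ ∷ w) ≡ invW w ++ [ flipL ℓ ]
    invW-∷ = LP.unfold-reverse (flipL ℓ) (map flipL w)

  -- The
  -- point x₀ (in the class named eD) detects elements of D₄.  The actions
  -- σ̂, τ̂ of σ₁, τ are kept abstract here: unfolding the concrete
  -- permutations during type checking is prohibitively expensive.
  module Criterion
    (equivariant : ∀ ℓ y → κ (letter ℓ y) ≡ κ y ·D letterD ℓ)
    (σ̂ τ̂ : V n → V n)
    (σ̂-letter : ∀ y → act [ σL ] y ≡ σ̂ y)
    (τ̂-letter : ∀ y → act [ τL ] y ≡ τ̂ y)
    (σ⁴≡id : ∀ y → σ̂ (σ̂ (σ̂ (σ̂ y))) ≡ y)
    (τ²≡id : ∀ y → τ̂ (τ̂ y) ≡ y)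
    (στ≡τσ³ : ∀ y → σ̂ (τ̂ y) ≡ τ̂ (σ̂ (σ̂ (σ̂ y))))
    (x₀ : V n) (κx₀ : κ x₀ ≡ eD) where

    κ-act : ∀ w y → κ (act w y) ≡ κ y ·W w
    κ-act [] y = refl
    κ-act (ℓ ∷ w) y = trans (κ-act w (letter ℓ y)) (cong (_·W w) (equivariant ℓ y))

    σ^ : ℕ → V n → V n
    σ^ zero y = y
    σ^ (suc m) y = σ^ m (σ̂ y)

    σ^-+ : ∀ a b y → σ^ (a + b) y ≡ σ^ b (σ^ a y)
    σ^-+ zero b y = refl
    σ^-+ (suc a) b y = σ^-+ a b (σ̂ y)

    σ^-mod4 : ∀ m y → σ^ m y ≡ σ^ (m % 4) y
    σ^-mod4 m y = begin
       σ^ m y                        ≡⟨ cong (λ z → σ^ z y) (m≡m%n+[m/n]*n m 4) ⟩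
       σ^ (m % 4 + (m / 4) * 4) y    ≡⟨ σ^-+ (m % 4) _ y ⟩
       σ^ ((m / 4) * 4) (σ^ (m % 4) y) ≡⟨ σ^4k (m / 4) _ ⟩
       σ^ (m % 4) y                  ∎
      where
      open ≡-Reasoning
      σ^4k : ∀ k y → σ^ (k * 4) y ≡ y
      σ^4k zero y = refl
      σ^4k (suc k) y = trans (σ^-+ 4 (k * 4) y) (trans (σ^4k k _) (σ⁴≡id y))

    σ^-Fin : ∀ m y → σ^ (toℕ (m mod 4)) y ≡ σ^ m y
    σ^-Fin m y = trans (cong (λ z → σ^ z y) (FinP.toℕ-fromℕ< (m%n<n m 4))) (sym (σ^-mod4 m y))

    σ^-τ : ∀ b z → σ^ b (τ̂ z) ≡ τ̂ (σ^ (b * 3) z)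
    σ^-τ zero z = refl
    σ^-τ (suc b) z = trans (cong (σ^ b) (στ≡τσ³ z)) (trans (σ^-τ b _) (cong τ̂ (sym (σ^-+ 3 (b * 3) z))))

    normalPerm : D4 → V n → V n
    normalPerm (a , false) y = σ^ (toℕ a) y
    normalPerm (a , true) y = τ̂ (σ^ (toℕ a) y)

    act-replicate : ∀ m y → act (replicate m σL) y ≡ σ^ m y
    act-replicate zero y = refl
    act-replicate (suc m) y = begin
      act ([ σL ] ++ replicate m σL) y     ≡⟨ act-++ [ σL ] (replicate m σL) y ⟩
      act (replicate m σL) (act [ σL ] y)  ≡⟨ act-replicate m (act [ σL ] y) ⟩
      σ^ m (act [ σL ] y)                  ≡⟨ cong (σ^ m) (σ̂-letter y) ⟩
      σ^ m (σ̂ y)                           ∎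
      where open ≡-Reasoning

    -- appending a letter whose action is known; kept generic in the letter
    -- so that the concrete action of τ is never unfolded
    act-snoc : ∀ ℓ (F : V n → V n) → (∀ z → act [ ℓ ] z ≡ F z) → ∀ u y → act (u ++ [ ℓ ]) y ≡ F (act u y)
    act-snoc ℓ F ℓ≡F u y = trans (act-++ u [ ℓ ] y) (ℓ≡F (act u y))

    act-normalWord : ∀ d y → act (normalWord d) y ≡ normalPerm d y
    act-normalWord (a , false) y = act-replicate (toℕ a) y
    act-normalWord (a , true) y =
      trans (act-snoc τL τ̂ τ̂-letter (replicate (toℕ a) σL) y) (cong τ̂ (act-replicate (toℕ a) y))

    σ^-rotation : ∀ (a b : Fin 4) y → σ^ (toℕ ((toℕ a + (4 ∸ toℕ b)) mod 4)) y ≡ σ^ (toℕ a + toℕ b * 3) y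
    σ^-rotation a b y = begin
      σ^ (toℕ ((toℕ a + (4 ∸ toℕ b)) mod 4)) y ≡⟨ σ^-Fin (toℕ a + (4 ∸ toℕ b)) y ⟩
      σ^ (toℕ a + (4 ∸ toℕ b)) y              ≡⟨ σ^-mod4 (toℕ a + (4 ∸ toℕ b)) y ⟩
      σ^ ((toℕ a + (4 ∸ toℕ b)) % 4) y        ≡⟨ cong (λ z → σ^ z y) (rotation-mod4 a b) ⟩
      σ^ ((toℕ a + toℕ b * 3) % 4) y          ≡⟨ sym (σ^-mod4 (toℕ a + toℕ b * 3) y) ⟩
      σ^ (toℕ a + toℕ b * 3) y                ∎
      where open ≡-Reasoning

    normalPerm-hom : ∀ d e y → normalPerm (d ·D e) y ≡ normalPerm e (normalPerm d y)
    normalPerm-hom (a , false) (b , false) y = trans (σ^-Fin (toℕ a + toℕ b) y) (σ^-+ (toℕ a) (toℕ b) y)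
    normalPerm-hom (a , false) (b , true) y = cong τ̂ (trans (σ^-Fin (toℕ a + toℕ b) y) (σ^-+ (toℕ a) (toℕ b) y))
    normalPerm-hom (a , true) (b , false) y =
      trans (cong τ̂ (trans (σ^-rotation a b y) (σ^-+ (toℕ a) (toℕ b * 3) y))) (sym (σ^-τ (toℕ b) _))
    normalPerm-hom (a , true) (b , true) y =
      trans (trans (σ^-rotation a b y) (σ^-+ (toℕ a) (toℕ b * 3) y))
        (trans (sym (τ²≡id _)) (cong τ̂ (sym (σ^-τ (toℕ b) _))))

    κ-normalWord : ∀ d y → κ (act (normalWord d) y) ≡ κ y ·D d
    κ-normalWord d y = begin
      κ (act (normalWord d) y)      ≡⟨ κ-act (normalWord d) y ⟩
      κ y ·W normalWord d           ≡⟨ ·W-factor (κ y) (normalWord d) ⟩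
      κ y ·D (eD ·W normalWord d)   ≡⟨ cong (κ y ·D_) (normalWord-image d) ⟩
      κ y ·D d                      ∎
      where open ≡-Reasoning

    κ-normalWord-x₀ : ∀ d → κ (act (normalWord d) x₀) ≡ d
    κ-normalWord-x₀ d = trans (κ-normalWord d x₀) (trans (cong (_·D d) κx₀) (·D-identityˡ d))

    normal : ∀ g l → InΛ l → InΛ (invW g ++ l ++ g)
    normal g l l∈Λ x = κ-injective (act (invW g ++ l ++ g) x) x (begin
        κ (act (invW g ++ l ++ g) x) ≡⟨ cong κ (act-++ (invW g) (l ++ g) x) ⟩
        κ (act (l ++ g) z)           ≡⟨ cong κ (act-++ l g z) ⟩
        κ (act g (act l z))          ≡⟨ κ-act g _ ⟩
        κ (act l z) ·W g             ≡⟨ cong (λ u → uncurry classD u ·W g) (l∈Λ z) ⟩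
        κ z ·W g                     ≡⟨ cong (_·W g) (κ-act (invW g) x) ⟩
        (κ x ·W invW g) ·W g         ≡⟨ ·W-invW (κ x) g ⟩
        κ x                          ∎)
      where
      open ≡-Reasoning
      z = act (invW g) x

    hom : ∀ d e → normalWord (d ·D e) ≈ (normalWord d ++ normalWord e)
    hom d e x = begin
        act (normalWord (d ·D e)) x              ≡⟨ act-normalWord (d ·D e) x ⟩
        normalPerm (d ·D e) x                    ≡⟨ normalPerm-hom d e x ⟩
        normalPerm e (normalPerm d x)            ≡⟨ sym (trans (act-normalWord e _) (cong (normalPerm e) (act-normalWord d x))) ⟩
        act (normalWord e) (act (normalWord d) x) ≡⟨ sym (act-++ (normalWord d) (normalWord e) x) ⟩
        act (normalWord d ++ normalWord e) x      ∎
      where open ≡-Reasoning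

    injective : ∀ d e → normalWord d ≈ normalWord e → d ≡ e
    injective d e eq = trans (sym (κ-normalWord-x₀ d)) (trans (cong κ (eq x₀)) (κ-normalWord-x₀ e))

    trivial-meet : ∀ d → InΛ (normalWord d) → d ≡ eD
    trivial-meet d d∈Λ = trans (sym (κ-normalWord-x₀ d)) (trans (cong (uncurry classD) (d∈Λ x₀)) κx₀)

    -- g = (g · σ₁^a' τ^e') · σ₁^a τ^e where r^a s^e = ∂g and r^a' s^e' = ∂g⁻¹
    decompose : ∀ g → Σ[ l ∈ Word ] Σ[ d ∈ D4 ] (InΛ l × (g ≈ (l ++ normalWord d)))
    decompose g = (g ++ normalWord d⁻¹) , d , l∈Λ , g≈
      where
      d = eD ·W g
      d⁻¹ = invD d
      l∈Λ : InΛ (g ++ normalWord d⁻¹)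
      l∈Λ x = κ-injective (act (g ++ normalWord d⁻¹) x) x (begin
          κ (act (g ++ normalWord d⁻¹) x)          ≡⟨ cong κ (act-++ g (normalWord d⁻¹) x) ⟩
          κ (act (normalWord d⁻¹) (act g x))       ≡⟨ κ-normalWord d⁻¹ _ ⟩
          κ (act g x) ·D d⁻¹                       ≡⟨ cong (_·D d⁻¹) (κ-act g x) ⟩
          (κ x ·W g) ·D d⁻¹                        ≡⟨ cong (_·D d⁻¹) (·W-factor (κ x) g) ⟩
          (κ x ·D d) ·D d⁻¹                        ≡⟨ ·D-cancelʳ (κ x) d ⟩
          κ x                                      ∎)
        where open ≡-Reasoning
      g≈ : g ≈ ((g ++ normalWord d⁻¹) ++ normalWord d)
      g≈ x = sym (begin
          act ((g ++ normalWord d⁻¹) ++ normalWord d) x       ≡⟨ act-++ (g ++ normalWord d⁻¹) (normalWord d) x ⟩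
          act (normalWord d) (act (g ++ normalWord d⁻¹) x)    ≡⟨ cong (act (normalWord d)) (act-++ g (normalWord d⁻¹) x) ⟩
          act (normalWord d) (act (normalWord d⁻¹) (act g x)) ≡⟨ act-normalWord d _ ⟩
          normalPerm d (act (normalWord d⁻¹) (act g x))       ≡⟨ cong (normalPerm d) (act-normalWord d⁻¹ _) ⟩
          normalPerm d (normalPerm d⁻¹ (act g x))             ≡⟨ sym (normalPerm-hom d⁻¹ d _) ⟩
          normalPerm (d⁻¹ ·D d) (act g x)                     ≡⟨ cong (λ u → normalPerm u (act g x)) (·D-inverseˡ d) ⟩
          act g x                                             ∎)
        where open ≡-Reasoning

    semidirect : SemidirectΛD4
    semidirect = normal , normalWord , hom , injective , trivial-meet , decompose

  cyc₄-a : ∀ a b c d → applyCycle (a ∷ b ∷ c ∷ d ∷ []) a ≡ b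
  cyc₄-a a b c d with a ≟V a
  ... | yes _ = refl
  ... | no a≢a = ⊥-elim (a≢a refl)

  cyc₄-b : ∀ a b c d → b ≢ a → applyCycle (a ∷ b ∷ c ∷ d ∷ []) b ≡ c
  cyc₄-b a b c d b≢a with b ≟V a
  ... | yes b≡a = ⊥-elim (b≢a b≡a)
  ... | no _ with b ≟V b
  ...   | yes _ = refl
  ...   | no b≢b = ⊥-elim (b≢b refl)

  cyc₄-c : ∀ a b c d → c ≢ a → c ≢ b → applyCycle (a ∷ b ∷ c ∷ d ∷ []) c ≡ d
  cyc₄-c a b c d c≢a c≢b with c ≟V a
  ... | yes c≡a = ⊥-elim (c≢a c≡a)
  ... | no _ with c ≟V b
  ...   | yes c≡b = ⊥-elim (c≢b c≡b)
  ...   | no _ with c ≟V c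
  ...     | yes _ = refl
  ...     | no c≢c = ⊥-elim (c≢c refl)

  cyc₄-d : ∀ a b c d → d ≢ a → d ≢ b → d ≢ c → applyCycle (a ∷ b ∷ c ∷ d ∷ []) d ≡ a
  cyc₄-d a b c d d≢a d≢b d≢c with d ≟V a
  ... | yes d≡a = ⊥-elim (d≢a d≡a)
  ... | no _ with d ≟V b
  ...   | yes d≡b = ⊥-elim (d≢b d≡b)
  ...   | no _ with d ≟V c
  ...     | yes d≡c = ⊥-elim (d≢c d≡c)
  ...     | no _ with d ≟V d
  ...       | yes _ = refl
  ...       | no d≢d = ⊥-elim (d≢d refl)

  cyc₄-out : ∀ a b c d y → ¬ y ∈ (a ∷ b ∷ c ∷ d ∷ []) → applyCycle (a ∷ b ∷ c ∷ d ∷ []) y ≡ y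
  cyc₄-out a b c d y y∉ with y ≟V a
  ... | yes y≡a = ⊥-elim (y∉ (here y≡a))
  ... | no _ with y ≟V b
  ...   | yes y≡b = ⊥-elim (y∉ (there (here y≡b)))
  ...   | no _ with y ≟V c
  ...     | yes y≡c = ⊥-elim (y∉ (there (there (here y≡c))))
  ...     | no _ with y ≟V d
  ...       | yes y≡d = ⊥-elim (y∉ (there (there (there (here y≡d)))))
  ...       | no _ = refl

  cyc₂-a : ∀ a b → applyCycle (a ∷ b ∷ []) a ≡ b
  cyc₂-a a b with a ≟V a
  ... | yes _ = refl
  ... | no a≢a = ⊥-elim (a≢a refl)

  cyc₂-b : ∀ a b → b ≢ a → applyCycle (a ∷ b ∷ []) b ≡ a
  cyc₂-b a b b≢a with b ≟V a
  ... | yes b≡a = ⊥-elim (b≢a b≡a)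
  ... | no _ with b ≟V b
  ...   | yes _ = refl
  ...   | no b≢b = ⊥-elim (b≢b refl)

  cyc₂-out : ∀ a b y → ¬ y ∈ (a ∷ b ∷ []) → applyCycle (a ∷ b ∷ []) y ≡ y
  cyc₂-out a b y y∉ with y ≟V a
  ... | yes y≡a = ⊥-elim (y∉ (here y≡a))
  ... | no _ with y ≟V b
  ...   | yes y≡b = ⊥-elim (y∉ (there (here y≡b)))
  ...   | no _ = refl

  -- The class conditions force the points of
  -- such a cycle to be distinct.

  RotSteps : V n → V n → V n → V n → Set
  RotSteps a b c d = (κ b ≡ κ a ·D r) × (κ c ≡ κ b ·D r) × (κ d ≡ κ c ·D r)

  RotCycle : Cycle → Set
  RotCycle cy = Σ[ a ∈ V n ] Σ[ b ∈ V n ] Σ[ c ∈ V n ] Σ[ d ∈ V n ]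
    (cy ≡ a ∷ b ∷ c ∷ d ∷ []) × RotSteps a b c d

  FlipPair : Cycle → Set
  FlipPair cy = Σ[ a ∈ V n ] Σ[ b ∈ V n ] (cy ≡ a ∷ b ∷ []) × (κ b ≡ κ a ·D s)

  r¹-apart : ∀ x y → κ y ≡ κ x ·D r → y ≢ x
  r¹-apart x .x e refl = r¹-free (κ x) (sym e)

  r²-apart : ∀ x y z → κ y ≡ κ x ·D r → κ z ≡ κ y ·D r → z ≢ x
  r²-apart x y .x e₁ e₂ refl = r²-free (κ x) (sym (trans e₂ (cong (_·D r) e₁)))

  r³-apart : ∀ x y z w → κ y ≡ κ x ·D r → κ z ≡ κ y ·D r → κ w ≡ κ z ·D r → w ≢ x
  r³-apart x y z .x e₁ e₂ e₃ refl =
    r³-free (κ x) (sym (trans e₃ (cong (_·D r) (trans e₂ (cong (_·D r) e₁)))))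

  s-apart : ∀ x y → κ y ≡ κ x ·D s → y ≢ x
  s-apart x .x e refl = s-free (κ x) (sym e)

  rot-action : ∀ a b c d → RotSteps a b c d →
    (applyCycle (a ∷ b ∷ c ∷ d ∷ []) a ≡ b) × (applyCycle (a ∷ b ∷ c ∷ d ∷ []) b ≡ c) ×
    (applyCycle (a ∷ b ∷ c ∷ d ∷ []) c ≡ d) × (applyCycle (a ∷ b ∷ c ∷ d ∷ []) d ≡ a)
  rot-action a b c d (k₁ , k₂ , k₃) =
    cyc₄-a a b c d ,
    cyc₄-b a b c d (r¹-apart a b k₁) ,
    cyc₄-c a b c d (r²-apart a b c k₁ k₂) (r¹-apart b c k₂) ,
    cyc₄-d a b c d (r³-apart a b c d k₁ k₂ k₃) (r²-apart b c d k₂ k₃) (r¹-apart c d k₃)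

  rot-wrap : ∀ a b c d → RotSteps a b c d → κ a ≡ κ d ·D r
  rot-wrap a b c d (k₁ , k₂ , k₃) =
    sym (trans (cong (_·D r) (trans k₃ (cong (_·D r) (trans k₂ (cong (_·D r) k₁))))) (r-order4 (κ a)))

  rot-fix : ∀ {cy y} → RotCycle cy → ¬ y ∈ cy → applyCycle cy y ≡ y
  rot-fix {y = y} (a , b , c , d , refl , _) = cyc₄-out a b c d y

  moved-within : ∀ cy x {z δ} → applyCycle cy x ≡ z → z ∈ cy → κ z ≡ κ x ·D δ →
    (applyCycle cy x ∈ cy) × (κ (applyCycle cy x) ≡ κ x ·D δ)
  moved-within cy x refl z∈cy κz = z∈cy , κz

  rot-step : ∀ {cy y} → RotCycle cy → y ∈ cy → (applyCycle cy y ∈ cy) × (κ (applyCycle cy y) ≡ κ y ·D r)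
  rot-step (a , b , c , d , refl , st) (here refl) =
    moved-within (a ∷ b ∷ c ∷ d ∷ []) a (proj₁ (rot-action a b c d st)) (there (here refl)) (proj₁ st)
  rot-step (a , b , c , d , refl , st) (there (here refl)) =
    moved-within (a ∷ b ∷ c ∷ d ∷ []) b (proj₁ (proj₂ (rot-action a b c d st))) (there (there (here refl))) (proj₁ (proj₂ st))
  rot-step (a , b , c , d , refl , st) (there (there (here refl))) =
    moved-within (a ∷ b ∷ c ∷ d ∷ []) c (proj₁ (proj₂ (proj₂ (rot-action a b c d st)))) (there (there (there (here refl)))) (proj₂ (proj₂ st))
  rot-step (a , b , c , d , refl , st) (there (there (there (here refl)))) =
    moved-within (a ∷ b ∷ c ∷ d ∷ []) d (proj₂ (proj₂ (proj₂ (rot-action a b c d st)))) (here refl) (rot-wrap a b c d st)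

  rot-inverse : ∀ {cy} y → RotCycle cy → applyCycle cy (applyCycle (reverse cy) y) ≡ y
  rot-inverse y (a , b , c , d , refl , st@(k₁ , k₂ , k₃)) with y ∈? (a ∷ b ∷ c ∷ d ∷ [])
  ... | yes (here refl) =
    trans (cong forward (cyc₄-d d c b a (≢-sym (r³-apart a b c d k₁ k₂ k₃)) (≢-sym (r²-apart a b c k₁ k₂)) (≢-sym (r¹-apart a b k₁))))
          (proj₂ (proj₂ (proj₂ (rot-action a b c d st))))
    where forward = applyCycle (a ∷ b ∷ c ∷ d ∷ [])
  ... | yes (there (here refl)) =
    trans (cong forward (cyc₄-c d c b a (≢-sym (r²-apart b c d k₂ k₃)) (≢-sym (r¹-apart b c k₂))))
          (proj₁ (rot-action a b c d st))
    where forward = applyCycle (a ∷ b ∷ c ∷ d ∷ [])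
  ... | yes (there (there (here refl))) =
    trans (cong forward (cyc₄-b d c b a (≢-sym (r¹-apart c d k₃)))) (proj₁ (proj₂ (rot-action a b c d st)))
    where forward = applyCycle (a ∷ b ∷ c ∷ d ∷ [])
  ... | yes (there (there (there (here refl)))) =
    trans (cong forward (cyc₄-a d c b a)) (proj₁ (proj₂ (proj₂ (rot-action a b c d st))))
    where forward = applyCycle (a ∷ b ∷ c ∷ d ∷ [])
  ... | no y∉ = trans (cong (applyCycle (a ∷ b ∷ c ∷ d ∷ [])) (cyc₄-out d c b a y (λ m → y∉ (AnyP.reverse⁻ m))))
                      (cyc₄-out a b c d y y∉)

  flip-fix : ∀ {cy y} → FlipPair cy → ¬ y ∈ cy → applyCycle cy y ≡ y
  flip-fix {y = y} (a , b , refl , _) = cyc₂-out a b y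

  flip-step : ∀ {cy y} → FlipPair cy → y ∈ cy → (applyCycle cy y ∈ cy) × (κ (applyCycle cy y) ≡ κ y ·D s)
  flip-step (a , b , refl , k) (here refl) = moved-within (a ∷ b ∷ []) a (cyc₂-a a b) (there (here refl)) k
  flip-step (a , b , refl , k) (there (here refl)) =
    moved-within (a ∷ b ∷ []) b (cyc₂-b a b (s-apart a b k)) (here refl) (sym (trans (cong (_·D s) k) (·D-cancelʳ (κ a) s)))

  flip-inverse : ∀ {cy} y → FlipPair cy → applyCycle cy (applyCycle (reverse cy) y) ≡ y
  flip-inverse y (a , b , refl , k) with y ∈? (a ∷ b ∷ [])
  ... | yes (here refl) =
    trans (cong (applyCycle (a ∷ b ∷ [])) (cyc₂-b b a (≢-sym (s-apart a b k)))) (cyc₂-b a b (s-apart a b k))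
  ... | yes (there (here refl)) = trans (cong (applyCycle (a ∷ b ∷ [])) (cyc₂-a b a)) (cyc₂-a a b)
  ... | no y∉ = trans (cong (applyCycle (a ∷ b ∷ [])) (cyc₂-out b a y (λ m → y∉ (AnyP.reverse⁻ m))))
                      (cyc₂-out a b y y∉)

  InSupport : V n → List Cycle → Set
  InSupport y cs = Any (y ∈_) cs

  Apart : Cycle → Cycle → Set
  Apart c c' = ∀ {y} → y ∈ c → y ∈ c' → ⊥

  Disjoint : List Cycle → Set
  Disjoint = AllPairs Apart

  apart-support : ∀ {c cs y} → All (Apart c) cs → y ∈ c → ¬ InSupport y cs
  apart-support ap y∈c y∈cs with find y∈cs
  ... | c' , c'∈cs , y∈c' = All.lookup ap c'∈cs y∈c y∈c'

  module DisjointProduct (Sh : Cycle → Set) (δ : D4)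
    (fix : ∀ {cy y} → Sh cy → ¬ y ∈ cy → applyCycle cy y ≡ y)
    (step : ∀ {cy y} → Sh cy → y ∈ cy → (applyCycle cy y ∈ cy) × (κ (applyCycle cy y) ≡ κ y ·D δ))
    (inverse : ∀ {cy} y → Sh cy → applyCycle cy (applyCycle (reverse cy) y) ≡ y) where

    product-outside : ∀ cs y → All Sh cs → ¬ InSupport y cs → applyProd cs y ≡ y
    product-outside [] y _ _ = refl
    product-outside (c ∷ cs) y (sh ∷ shs) y∉ rewrite fix sh (λ m → y∉ (here m)) =
      product-outside cs y shs (λ m → y∉ (there m))

    product-on-cycle : ∀ cs c y → All Sh cs → Disjoint cs → c ∈ cs → y ∈ c → applyProd cs y ≡ applyCycle c y
    product-on-cycle (c₀ ∷ cs) c y (sh ∷ shs) (ap ∷ _) (here refl) y∈c =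
      product-outside cs _ shs (apart-support ap (proj₁ (step sh y∈c)))
    product-on-cycle (c₀ ∷ cs) c y (sh ∷ shs) (ap ∷ aps) (there c∈cs) y∈c
      rewrite fix sh (λ y∈c₀ → apart-support ap y∈c₀ (lose c∈cs y∈c)) =
      product-on-cycle cs c y shs aps c∈cs y∈c

    product-shifts : ∀ cs y → All Sh cs → Disjoint cs → InSupport y cs → κ (applyProd cs y) ≡ κ y ·D δ
    product-shifts cs y shs dj y∈cs with find y∈cs
    ... | c , c∈cs , y∈c = trans (cong κ (product-on-cycle cs c y shs dj c∈cs y∈c)) (proj₂ (step (All.lookup shs c∈cs) y∈c))

    product-inverse : ∀ cs y → All Sh cs → applyProd cs (applyProd (invProd cs) y) ≡ y
    product-inverse [] y _ = refl
    product-inverse (c ∷ cs) y (sh ∷ shs) = begin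
        applyProd (c ∷ cs) (applyProd (invProd (c ∷ cs)) y)
          ≡⟨ cong (λ l → applyProd (c ∷ cs) (applyProd l y)) (LP.unfold-reverse (reverse c) (map reverse cs)) ⟩
        applyProd (c ∷ cs) (applyProd (invProd cs ++ [ reverse c ]) y)
          ≡⟨ cong (applyProd (c ∷ cs)) (LP.foldl-++ _ y (invProd cs) [ reverse c ]) ⟩
        applyProd cs (applyCycle c (applyCycle (reverse c) w))
          ≡⟨ cong (applyProd cs) (inverse w sh) ⟩
        applyProd cs w
          ≡⟨ product-inverse cs y shs ⟩
        y ∎
      where
      open ≡-Reasoning
      w = applyProd (invProd cs) y

  module RotProduct = DisjointProduct RotCycle r rot-fix rot-step rot-inverse
  module FlipProduct = DisjointProduct FlipPair s flip-fix flip-step flip-inverse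

  disjoint-concatMap : ∀ {A : Set} (G : A → List Cycle) (R : A → A → Set) {L : List A} → AllPairs R L →
    (∀ a → Disjoint (G a)) → (∀ {a b y} → R a b → InSupport y (G a) → InSupport y (G b) → ⊥) →
    Disjoint (concatMap G L)
  disjoint-concatMap G R {L} R-pairs inner cross =
    APP.concat⁺ (AllP.map⁺ (All.universal inner L)) (APP.map⁺ (AP.map separate R-pairs))
    where
    separate : ∀ {a b} → R a b → All (λ c → All (Apart c) (G b)) (G a)
    separate Rab = All.tabulate λ c∈ → All.tabulate λ c'∈ → λ u v → cross Rab (lose c∈ u) (lose c'∈ v)

  InSupport-concatMap : ∀ {A : Set} (G : A → List Cycle) {L : List A} {a c y} →
    a ∈ L → c ∈ G a → y ∈ c → InSupport y (concatMap G L)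
  InSupport-concatMap G a∈L c∈Ga y∈c = AnyP.concatMap⁺ G (lose a∈L (lose c∈Ga y∈c))

  All-concatMap : ∀ {A : Set} {P : Cycle → Set} (G : A → List Cycle) {L : List A} →
    (∀ a → All P (G a)) → All P (concatMap G L)
  All-concatMap G {L} all = AllP.concat⁺ (AllP.map⁺ (All.universal all L))

  equivariant-inverse : ∀ cs δ → (∀ x → κ (applyProd cs x) ≡ κ x ·D δ) →
    (∀ y → applyProd cs (applyProd (invProd cs) y) ≡ y) →
    ∀ y → κ (applyProd (invProd cs) y) ≡ κ y ·D invD δ
  equivariant-inverse cs δ shifts inv y = begin
      κ x                       ≡⟨ sym (·D-cancelʳ (κ x) δ) ⟩
      (κ x ·D δ) ·D invD δ      ≡⟨ cong (_·D invD δ) (sym (shifts x)) ⟩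
      κ (applyProd cs x) ·D invD δ ≡⟨ cong (λ z → κ z ·D invD δ) (inv y) ⟩
      κ y ·D invD δ             ∎
    where
    open ≡-Reasoning
    x = applyProd (invProd cs) y

  N : ℕ
  N = 4 * n

  point : ℕ → ℕ → Bool → V n
  point i e p = ((4 * i + e) mod N , p)

  toℕ-mod : ∀ L → toℕ (L mod N) ≡ L % N
  toℕ-mod L = FinP.toℕ-fromℕ< _

  point-≡ : ∀ i e j e' p → (4 * i + e) % N ≡ (4 * j + e') % N → point i e p ≡ point j e' p
  point-≡ i e j e' p eq = cong (_, p) (FinP.toℕ-injective (trans (toℕ-mod _) (trans eq (sym (toℕ-mod _)))))

  residue-4i+e : ∀ i e → (4 * i + e) % 4 ≡ e % 4
  residue-4i+e i e = trans (cong (_% 4) (NP.+-comm (4 * i) e))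
    (trans (cong (λ z → (e + z) % 4) (NP.*-comm 4 i)) ([m+kn]%n≡m%n e i 4))

  -- since 4 ∣ 4n, reduction modulo 4n keeps the residue modulo 4
  label-residue : ∀ i e → toℕ ((4 * i + e) mod N) % 4 ≡ e % 4
  label-residue i e = trans (cong (_% 4) (toℕ-mod _))
    (trans (m∣n⇒o%n%m≡o%m 4 N (4 * i + e) (divides n (NP.*-comm 4 n))) (residue-4i+e i e))

  κ-point : ∀ i e p → κ (point i e p) ≡ classD (e % 4) p
  κ-point i e p = cong (λ z → classD z p) (label-residue i e)

  point-residue : ∀ i e j e' {p p'} → point i e p ≡ point j e' p' → e % 4 ≡ e' % 4
  point-residue i e j e' eq =
    trans (sym (label-residue i e)) (trans (cong (λ y → toℕ (proj₁ y) % 4) eq) (label-residue j e'))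

  reduce-block : ∀ m ρ → (4 * m + ρ) % N ≡ (4 * (m % n) + ρ) % N
  reduce-block m ρ = begin
      (4 * m + ρ) % N                       ≡⟨ cong (λ z → (4 * z + ρ) % N) (m≡m%n+[m/n]*n m n) ⟩
      (4 * (m % n + (m / n) * n) + ρ) % N   ≡⟨ cong (_% N) (regroup (m % n) (m / n) n ρ) ⟩
      ((4 * (m % n) + ρ) + (m / n) * N) % N ≡⟨ [m+kn]%n≡m%n _ (m / n) N ⟩
      (4 * (m % n) + ρ) % N                 ∎
    where
    open ≡-Reasoning
    regroup : ∀ a b n ρ → 4 * (a + b * n) + ρ ≡ (4 * a + ρ) + b * (4 * n)
    regroup = solve-∀

  block-bound : ∀ i ρ → i < n → ρ < 4 → 4 * i + ρ < N
  block-bound i ρ i<n ρ<4 =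
    NP.≤-trans (NP.+-monoʳ-< (4 * i) ρ<4) (subst (_≤ N) (regroup i) (NP.*-monoʳ-≤ 4 i<n))
    where
    regroup : ∀ i → 4 * suc i ≡ 4 * i + 4
    regroup = solve-∀

  label-normal : ∀ i c → (4 * i + c) % N ≡ 4 * ((i + c / 4) % n) + c % 4
  label-normal i c = begin
      (4 * i + c) % N                     ≡⟨ cong (λ z → (4 * i + z) % N) (m≡m%n+[m/n]*n c 4) ⟩
      (4 * i + (c % 4 + (c / 4) * 4)) % N ≡⟨ cong (_% N) (regroup i (c % 4) (c / 4)) ⟩
      (4 * (i + c / 4) + c % 4) % N       ≡⟨ reduce-block (i + c / 4) (c % 4) ⟩
      (4 * ((i + c / 4) % n) + c % 4) % N ≡⟨ m<n⇒m%n≡m (block-bound _ _ (m%n<n _ n) (m%n<n c 4)) ⟩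
      4 * ((i + c / 4) % n) + c % 4       ∎
    where
    open ≡-Reasoning
    regroup : ∀ i a b → 4 * i + (a + b * 4) ≡ 4 * (i + b) + a
    regroup = solve-∀

  undo-shift : ∀ i c → ((i + c) + (n ∸ c % n)) % n ≡ i % n
  undo-shift i c = trans (cong (_% n) regrouped) ([m+kn]%n≡m%n i (suc (c / n)) n)
    where
    k = c % n
    d = n ∸ k
    k+d≡n : k + d ≡ n
    k+d≡n = NP.m+[n∸m]≡n (NP.<⇒≤ (m%n<n c n))
    regroup : ∀ i k q d → (i + (k + q * (k + d))) + d ≡ i + suc q * (k + d)
    regroup = solve-∀
    regrouped : (i + c) + d ≡ i + suc (c / n) * n
    regrouped = begin
        (i + c) + d                         ≡⟨ cong (λ z → (i + z) + d) (m≡m%n+[m/n]*n c n) ⟩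
        (i + (k + (c / n) * n)) + d         ≡⟨ cong (λ z → (i + (k + (c / n) * z)) + d) (sym k+d≡n) ⟩
        (i + (k + (c / n) * (k + d))) + d   ≡⟨ regroup i k (c / n) d ⟩
        i + suc (c / n) * (k + d)           ≡⟨ cong (λ z → i + suc (c / n) * z) k+d≡n ⟩
        i + suc (c / n) * n                 ∎
      where open ≡-Reasoning

  %-absorbˡ : ∀ x y → (x % n + y) % n ≡ (x + y) % n
  %-absorbˡ x y = trans (%-distribˡ-+ (x % n) y n)
    (trans (cong (λ z → (z + y % n) % n) (m%n%n≡m%n x n)) (sym (%-distribˡ-+ x y n)))

  shift-injective : ∀ i j c → i < n → j < n → (i + c) % n ≡ (j + c) % n → i ≡ j
  shift-injective i j c i<n j<n eq = begin
      i                         ≡⟨ sym (m<n⇒m%n≡m i<n) ⟩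
      i % n                     ≡⟨ sym (undo-shift i c) ⟩
      ((i + c) + d) % n         ≡⟨ sym (%-absorbˡ (i + c) d) ⟩
      ((i + c) % n + d) % n     ≡⟨ cong (λ z → (z + d) % n) eq ⟩
      ((j + c) % n + d) % n     ≡⟨ %-absorbˡ (j + c) d ⟩
      ((j + c) + d) % n         ≡⟨ undo-shift j c ⟩
      j % n                     ≡⟨ m<n⇒m%n≡m j<n ⟩
      j                         ∎
    where
    open ≡-Reasoning
    d = n ∸ c % n

  point-block : ∀ i j e {p p'} → i < n → j < n → point i e p ≡ point j e p' → i ≡ j
  point-block i j e i<n j<n eq = shift-injective i j (e / 4) i<n j<n
    (NP.*-cancelˡ-≡ _ _ 4 (NP.+-cancelʳ-≡ _ _ _
      (trans (sym (label-normal i e)) (trans labels≡ (label-normal j e)))))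
    where
    labels≡ : (4 * i + e) % N ≡ (4 * j + e) % N
    labels≡ = trans (sym (toℕ-mod _)) (trans (cong (λ y → toℕ (proj₁ y)) eq) (toℕ-mod _))

  cover-label : ∀ o q ρ → q < n → Σ[ i ∈ ℕ ] (i < n × (4 * i + (4 * o + ρ)) % N ≡ (4 * q + ρ) % N)
  cover-label o q ρ q<n = i , m%n<n _ n , (begin
      (4 * i + (4 * o + ρ)) % N    ≡⟨ cong (_% N) (regroup i o ρ) ⟩
      (4 * (i + o) + ρ) % N        ≡⟨ reduce-block (i + o) ρ ⟩
      (4 * ((i + o) % n) + ρ) % N  ≡⟨ cong (λ z → (4 * z + ρ) % N) i+o≡q ⟩
      (4 * q + ρ) % N              ∎)
    where
    open ≡-Reasoning
    regroup : ∀ i o ρ → 4 * i + (4 * o + ρ) ≡ 4 * (i + o) + ρ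
    regroup = solve-∀
    swap-last : ∀ q d o → q + d + o ≡ q + o + d
    swap-last = solve-∀
    d = n ∸ o % n
    i = (q + d) % n
    i+o≡q : (i + o) % n ≡ q
    i+o≡q = begin
      ((q + d) % n + o) % n ≡⟨ %-absorbˡ (q + d) o ⟩
      (q + d + o) % n       ≡⟨ cong (_% n) (swap-last q d o) ⟩
      (q + o + d) % n       ≡⟨ undo-shift q o ⟩
      q % n                 ≡⟨ m<n⇒m%n≡m q<n ⟩
      q                     ∎

  point-cover : ∀ (y : V n) → Σ[ q ∈ ℕ ] Σ[ ρ ∈ ℕ ] (q < n × ρ < 4 × y ≡ point q ρ (proj₂ y))
  point-cover (v , p) = q , ρ , q<n , m%n<n (toℕ v) 4 , cong (_, p) (FinP.toℕ-injective v≡)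
    where
    q = toℕ v / 4
    ρ = toℕ v % 4
    q<n : q < n
    q<n = m<n*o⇒m/o<n (subst (toℕ v <_) (NP.*-comm 4 n) (FinP.toℕ<n v))
    v≡ : toℕ v ≡ toℕ ((4 * q + ρ) mod N)
    v≡ = sym (begin
      toℕ ((4 * q + ρ) mod N) ≡⟨ toℕ-mod _ ⟩
      (4 * q + ρ) % N         ≡⟨ cong (_% N) (trans (NP.+-comm (4 * q) ρ) (trans (cong (ρ +_) (NP.*-comm 4 q)) (sym (m≡m%n+[m/n]*n (toℕ v) 4)))) ⟩
      toℕ v % N               ≡⟨ m<n⇒m%n≡m (FinP.toℕ<n v) ⟩
      toℕ v                   ∎)
      where open ≡-Reasoning

  -- A family of 4-cycles, an unprimed and a primed one for every block
  -- i < n; the cycle of block i runs through the labels 4i + entry k for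
  -- the positions k = 0, 1, 2, 3, where entry k ≡ k + 1 (mod 4).  Both σ₁
  -- (entries 1, 2, 3, 4) and σ₂ (entries 1, 4t+2, 4t+7, 8) have this form.
  module RotationFamily (entry : Fin 4 → ℕ) (entry-res : ∀ k → entry k % 4 ≡ res k) where

    fpt : ℕ → Fin 4 → Bool → V n
    fpt i k p = point i (entry k) p

    fcycle : ℕ → Bool → Cycle
    fcycle i p = tabulate (λ k → fpt i k p)

    fgroup : ℕ → List Cycle
    fgroup i = fcycle i false ∷ fcycle i true ∷ []

    cycles : List Cycle
    cycles = concatMap fgroup (upTo n)

    κ-fpt : ∀ i k p → κ (fpt i k p) ≡ classD (res k) p
    κ-fpt i k p = trans (κ-point i (entry k) p) (cong (λ z → classD z p) (entry-res k))

    fpt-position : ∀ i j k k' {p p'} → fpt i k p ≡ fpt j k' p' → k ≡ k'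
    fpt-position i j k k' eq = res-injective k k'
      (trans (sym (entry-res k)) (trans (point-residue i (entry k) j (entry k') eq) (entry-res k')))

    fpt-block : ∀ i j k k' {p p'} → i < n → j < n → fpt i k p ≡ fpt j k' p' → i ≡ j
    fpt-block i j k k' i<n j<n eq with fpt-position i j k k' eq
    ... | refl = point-block i j (entry k) i<n j<n eq

    fcycle-steps : ∀ i p → RotSteps (fpt i Fin.zero p) (fpt i (next Fin.zero) p)
      (fpt i (next (next Fin.zero)) p) (fpt i (next (next (next Fin.zero))) p)
    fcycle-steps i p = step Fin.zero , step (next Fin.zero) , step (next (next Fin.zero))
      where
      step : ∀ k → κ (fpt i (next k) p) ≡ κ (fpt i k p) ·D r
      step k = trans (κ-fpt i (next k) p) (trans (classD-next k p) (cong (_·D r) (sym (κ-fpt i k p))))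

    fcycle-next : ∀ i k p → applyCycle (fcycle i p) (fpt i k p) ≡ fpt i (next k) p
    fcycle-next i k p with rot-action (fpt i Fin.zero p) (fpt i (Fin.suc Fin.zero) p)
      (fpt i (Fin.suc (Fin.suc Fin.zero)) p) (fpt i (Fin.suc (Fin.suc (Fin.suc Fin.zero))) p) (fcycle-steps i p)
    fcycle-next i Fin.zero p | a↦b , _ = a↦b
    fcycle-next i (Fin.suc Fin.zero) p | _ , b↦c , _ = b↦c
    fcycle-next i (Fin.suc (Fin.suc Fin.zero)) p | _ , _ , c↦d , _ = c↦d
    fcycle-next i (Fin.suc (Fin.suc (Fin.suc Fin.zero))) p | _ , _ , _ , d↦a = d↦a

    all-rot : All RotCycle cycles
    all-rot = All-concatMap fgroup {upTo n} λ i → rot i false ∷ rot i true ∷ []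
      where
      rot : ∀ i p → RotCycle (fcycle i p)
      rot i p = _ , _ , _ , _ , refl , fcycle-steps i p

    fcycle∈fgroup : ∀ i p → fcycle i p ∈ fgroup i
    fcycle∈fgroup i false = here refl
    fcycle∈fgroup i true = there (here refl)

    fpt∈fcycle : ∀ i k p → fpt i k p ∈ fcycle i p
    fpt∈fcycle i k p = MP.∈-tabulate⁺ {f = λ k → fpt i k p} k

    ∈fcycle : ∀ {y} i p → y ∈ fcycle i p → Σ[ k ∈ Fin 4 ] y ≡ fpt i k p
    ∈fcycle i p = MP.∈-tabulate⁻ {f = λ k → fpt i k p}

    ∈fgroup : ∀ {y} i → InSupport y (fgroup i) → Σ[ p ∈ Bool ] Σ[ k ∈ Fin 4 ] y ≡ fpt i k p
    ∈fgroup i (here y∈) = false , ∈fcycle i false y∈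
    ∈fgroup i (there (here y∈)) = true , ∈fcycle i true y∈

    disjoint : Disjoint cycles
    disjoint = disjoint-concatMap fgroup Distinct
      (APP.applyUpTo⁺₁ (λ i → i) n (λ i<j j<n → NP.<⇒≢ i<j , NP.<-trans i<j j<n , j<n)) inner cross
      where
      Distinct : ℕ → ℕ → Set
      Distinct i j = (i ≢ j) × i < n × j < n
      inner : ∀ i → Disjoint (fgroup i)
      inner i = ((λ u v → primes-differ (∈fcycle i false u) (∈fcycle i true v)) ∷ []) ∷ [] ∷ []
        where
        primes-differ : ∀ {y} → Σ[ k ∈ Fin 4 ] y ≡ fpt i k false → Σ[ k ∈ Fin 4 ] y ≡ fpt i k true → ⊥
        primes-differ (_ , y≡) (_ , y≡') with trans (sym y≡) y≡'
        ... | ()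
      cross : ∀ {i j y} → Distinct i j → InSupport y (fgroup i) → InSupport y (fgroup j) → ⊥
      cross {i} {j} (i≢j , i<n , j<n) u v with ∈fgroup i u | ∈fgroup j v
      ... | _ , k , y≡ | _ , k' , y≡' = i≢j (fpt-block i j k k' i<n j<n (trans (sym y≡) y≡'))

    fpt-cover : ∀ y → Σ[ i ∈ ℕ ] Σ[ k ∈ Fin 4 ] (i < n × y ≡ fpt i k (proj₂ y))
    fpt-cover y with point-cover y
    ... | q , ρ , q<n , ρ<4 , y≡ with res-surjective ρ ρ<4
    ...   | k , refl with cover-label (entry k / 4) q (res k) q<n
    ...     | i , i<n , labels≡ = i , k , i<n , trans y≡ (sym fpt≡)
      where
      regroup : ∀ a b → a + b * 4 ≡ 4 * b + a
      regroup = solve-∀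
      entry-split : entry k ≡ 4 * (entry k / 4) + res k
      entry-split = trans (m≡m%n+[m/n]*n (entry k) 4)
        (trans (cong (_+ (entry k / 4) * 4) (entry-res k)) (regroup (res k) (entry k / 4)))
      fpt≡ : fpt i k (proj₂ y) ≡ point q (res k) (proj₂ y)
      fpt≡ = trans (cong (λ e → point i e (proj₂ y)) entry-split)
                   (point-≡ i _ q (res k) (proj₂ y) labels≡)

    on-fpt : ∀ i k p → i < n → applyProd cycles (fpt i k p) ≡ fpt i (next k) p
    on-fpt i k p i<n = trans
      (RotProduct.product-on-cycle cycles (fcycle i p) _ all-rot disjoint
        (AnyP.concatMap⁺ fgroup (lose (MP.∈-upTo⁺ i<n) (fcycle∈fgroup i p))) (fpt∈fcycle i k p))
      (fcycle-next i k p)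

    shifts : ∀ y → κ (applyProd cycles y) ≡ κ y ·D r
    shifts y with fpt-cover y
    ... | i , k , i<n , y≡ = RotProduct.product-shifts cycles y all-rot disjoint
      (InSupport-concatMap fgroup (MP.∈-upTo⁺ i<n) (fcycle∈fgroup i (proj₂ y))
        (subst (_∈ fcycle i (proj₂ y)) (sym y≡) (fpt∈fcycle i k (proj₂ y))))

    inverse : ∀ y → applyProd cycles (applyProd (invProd cycles) y) ≡ y
    inverse y = RotProduct.product-inverse cycles y all-rot

  module Σ₁ = RotationFamily (λ k → suc (toℕ k)) (λ k → refl)

  block : ℕ → Fin 4 → Bool → V n
  block = Σ₁.fpt

  σ₂-entry : Fin 4 → ℕ
  σ₂-entry Fin.zero = 1
  σ₂-entry (Fin.suc Fin.zero) = 4 * t + 2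
  σ₂-entry (Fin.suc (Fin.suc Fin.zero)) = 4 * t + 7
  σ₂-entry (Fin.suc (Fin.suc (Fin.suc Fin.zero))) = 8

  σ₂-entry-res : ∀ k → σ₂-entry k % 4 ≡ res k
  σ₂-entry-res Fin.zero = refl
  σ₂-entry-res (Fin.suc Fin.zero) = residue-4i+e t 2
  σ₂-entry-res (Fin.suc (Fin.suc Fin.zero)) = residue-4i+e t 7
  σ₂-entry-res (Fin.suc (Fin.suc (Fin.suc Fin.zero))) = refl

  module Σ₂ = RotationFamily σ₂-entry σ₂-entry-res

  σ₂-family : σ₂ ≡ Σ₂.cycles
  σ₂-family = LP.concatMap-cong (λ i → cong₂ (λ u v → u ∷ v ∷ []) (cycle≡ i false) (cycle≡ i true)) (upTo n)
    where
    cycle≡ : ∀ i p → ((4 * i + 1) mod N , p) ∷ ((4 * i + 4 * t + 2) mod N , p) ∷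
                     ((4 * i + 4 * t + 7) mod N , p) ∷ ((4 * i + 8) mod N , p) ∷ [] ≡ Σ₂.fcycle i p
    cycle≡ i p = cong₂ _∷_ refl (cong₂ _∷_ (cong (λ L → (L mod N , p)) (NP.+-assoc (4 * i) (4 * t) 2))
                   (cong₂ _∷_ (cong (λ L → (L mod N , p)) (NP.+-assoc (4 * i) (4 * t) 7)) refl))

  -- From here on 1 < n, t < n and t ≠ 1, which makes τ well defined.
  module Generators (1<n : 1 < n) (t<n : t < n) (t≢1 : t ≢ 1) where

    -- τ pairs the unprimed block i with the primed block swap i, where swap
    -- exchanges the blocks 1 and t and fixes every other block.
    swap : ℕ → ℕ
    swap i with i NP.≟ 1
    ... | yes _ = t
    ... | no _ with i NP.≟ t
    ...   | yes _ = 1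
    ...   | no _ = i

    swap-cases : ∀ i → ((i ≡ 1) × (swap i ≡ t)) ⊎ ((i ≡ t) × (swap i ≡ 1)) ⊎ ((i ≢ 1) × (i ≢ t) × (swap i ≡ i))
    swap-cases i with i NP.≟ 1
    ... | yes i≡1 = inj₁ (i≡1 , refl)
    ... | no i≢1 with i NP.≟ t
    ...   | yes i≡t = inj₂ (inj₁ (i≡t , refl))
    ...   | no i≢t = inj₂ (inj₂ (i≢1 , i≢t , refl))

    swap-1 : swap 1 ≡ t
    swap-1 with swap-cases 1
    ... | inj₁ (_ , e) = e
    ... | inj₂ (inj₁ (1≡t , _)) = ⊥-elim (t≢1 (sym 1≡t))
    ... | inj₂ (inj₂ (1≢1 , _ , _)) = ⊥-elim (1≢1 refl)

    swap-t : swap t ≡ 1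
    swap-t with swap-cases t
    ... | inj₁ (t≡1 , _) = ⊥-elim (t≢1 t≡1)
    ... | inj₂ (inj₁ (_ , e)) = e
    ... | inj₂ (inj₂ (_ , t≢t , _)) = ⊥-elim (t≢t refl)

    swap-involutive : ∀ i → swap (swap i) ≡ i
    swap-involutive i with swap-cases i
    ... | inj₁ (i≡1 , e) = trans (cong swap e) (trans swap-t (sym i≡1))
    ... | inj₂ (inj₁ (i≡t , e)) = trans (cong swap e) (trans swap-1 (sym i≡t))
    ... | inj₂ (inj₂ (_ , _ , e)) = trans (cong swap e) e

    swap<n : ∀ {i} → i < n → swap i < n
    swap<n {i} i<n with swap-cases i
    ... | inj₁ (_ , e) = subst (_< n) (sym e) t<n
    ... | inj₂ (inj₁ (_ , e)) = subst (_< n) (sym e) 1<n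
    ... | inj₂ (inj₂ (_ , _ , e)) = subst (_< n) (sym e) i<n

    τ-pair : ℕ → ℕ → Fin 4 → Cycle
    τ-pair i j m = tr (block i m false) (block j (mirror m) true)

    τ-group : ℕ × ℕ → List Cycle
    τ-group (i , j) = tabulate (τ-pair i j)

    keep : ℕ → Bool
    keep i = not (i ≡ᵇ 1) ∧ not (i ≡ᵇ t)

    others : List ℕ
    others = filterᵇ keep (upTo n)

    -- the pairs (i , swap i), in the order in which τ lists them
    τ-blocks : List (ℕ × ℕ)
    τ-blocks = (1 , t) ∷ (t , 1) ∷ map (λ i → (i , i)) others

    τ-family : τ ≡ concatMap τ-group τ-blocks
    τ-family = cong (λ X → τ-group (1 , t) ++ τ-group (t , 1) ++ concat X) (LP.map-∘ others)

    keep-sound : ∀ i → T (not (i ≡ᵇ 1) ∧ not (i ≡ᵇ t)) → (i ≢ 1) × (i ≢ t)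
    keep-sound i kept with i ≡ᵇ 1 in e₁ | i ≡ᵇ t in e₂
    ... | false | false = (λ i≡1 → subst T e₁ (NP.≡⇒≡ᵇ i 1 i≡1)) , (λ i≡t → subst T e₂ (NP.≡⇒≡ᵇ i t i≡t))
    ... | false | true = ⊥-elim kept
    ... | true | _ = ⊥-elim kept

    keep-complete : ∀ i → i ≢ 1 → i ≢ t → T (not (i ≡ᵇ 1) ∧ not (i ≡ᵇ t))
    keep-complete i i≢1 i≢t with i ≡ᵇ 1 in e₁ | i ≡ᵇ t in e₂
    ... | false | false = tt
    ... | false | true = ⊥-elim (i≢t (NP.≡ᵇ⇒≡ i t (subst T (sym e₂) tt)))
    ... | true | _ = ⊥-elim (i≢1 (NP.≡ᵇ⇒≡ i 1 (subst T (sym e₁) tt)))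

    others-sound : ∀ {i} → i ∈ others → (i < n) × (i ≢ 1) × (i ≢ t)
    others-sound {i} i∈ with MP.∈-filter⁻ (λ i → T? (keep i)) i∈
    ... | i∈upTo , kept = MP.∈-upTo⁻ i∈upTo , keep-sound i kept

    pair∈τ-blocks : ∀ i → i < n → (i , swap i) ∈ τ-blocks
    pair∈τ-blocks i i<n with swap-cases i
    ... | inj₁ (i≡1 , e) = here (cong₂ _,_ i≡1 e)
    ... | inj₂ (inj₁ (i≡t , e)) = there (here (cong₂ _,_ i≡t e))
    ... | inj₂ (inj₂ (i≢1 , i≢t , e)) = there (there (subst (λ j → (i , j) ∈ map (λ i → (i , i)) others) (sym e)
            (MP.∈-map⁺ (λ i → (i , i)) (MP.∈-filter⁺ (λ i → T? (keep i)) (MP.∈-upTo⁺ i<n) (keep-complete i i≢1 i≢t)))))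

    Separated : ℕ × ℕ → ℕ × ℕ → Set
    Separated (i , j) (i' , j') = (i ≢ i') × (j ≢ j') × (i < n) × (j < n) × (i' < n) × (j' < n)

    τ-blocks-separated : AllPairs Separated τ-blocks
    τ-blocks-separated =
      ((1≢t , t≢1 , 1<n , t<n , t<n , 1<n) ∷ AllP.map⁺ (All.tabulate from-1t)) ∷
      AllP.map⁺ (All.tabulate from-t1) ∷
      APP.map⁺ (APP.filter⁺ (λ i → T? (keep i)) (APP.applyUpTo⁺₁ (λ i → i) n
        (λ i<j j<n → NP.<⇒≢ i<j , NP.<⇒≢ i<j , NP.<-trans i<j j<n , NP.<-trans i<j j<n , j<n , j<n)))
      where
      1≢t : 1 ≢ t
      1≢t = ≢-sym t≢1
      from-1t : ∀ {i} → i ∈ others → Separated (1 , t) (i , i)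
      from-1t i∈ with others-sound i∈
      ... | i<n , i≢1 , i≢t = ≢-sym i≢1 , ≢-sym i≢t , 1<n , t<n , i<n , i<n
      from-t1 : ∀ {i} → i ∈ others → Separated (t , 1) (i , i)
      from-t1 i∈ with others-sound i∈
      ... | i<n , i≢1 , i≢t = ≢-sym i≢t , ≢-sym i≢1 , t<n , 1<n , i<n , i<n

    primes-differ : ∀ {a b : Fin (4 * n)} → (a , false) ≢ (b , true)
    primes-differ ()

    ∈τ-pair : ∀ {y} i j m → y ∈ τ-pair i j m → (y ≡ block i m false) ⊎ (y ≡ block j (mirror m) true)
    ∈τ-pair i j m (here y≡) = inj₁ y≡
    ∈τ-pair i j m (there (here y≡)) = inj₂ y≡

    τ-pair-position : ∀ {y} i j m m' → y ∈ τ-pair i j m → y ∈ τ-pair i j m' → m ≡ m'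
    τ-pair-position i j m m' u v with ∈τ-pair i j m u | ∈τ-pair i j m' v
    ... | inj₁ y≡ | inj₁ y≡' = Σ₁.fpt-position i i m m' (trans (sym y≡) y≡')
    ... | inj₂ y≡ | inj₂ y≡' =
      trans (sym (mirror-involutive m))
        (trans (cong mirror (Σ₁.fpt-position j j (mirror m) (mirror m') (trans (sym y≡) y≡'))) (mirror-involutive m'))
    ... | inj₁ y≡ | inj₂ y≡' = ⊥-elim (primes-differ (trans (sym y≡) y≡'))
    ... | inj₂ y≡ | inj₁ y≡' = ⊥-elim (primes-differ (trans (sym y≡') y≡))

    τ-group-disjoint : ∀ a → Disjoint (τ-group a)
    τ-group-disjoint (i , j) =
      APP.tabulate⁺ {f = τ-pair i j} λ {m} {m'} m≢m' u v → m≢m' (τ-pair-position i j m m' u v)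

    τ-groups-apart : ∀ {a b y} → Separated a b → InSupport y (τ-group a) → InSupport y (τ-group b) → ⊥
    τ-groups-apart {i , j} {i' , j'} (i≢i' , j≢j' , i<n , j<n , i'<n , j'<n) u v
      with AnyP.tabulate⁻ {f = τ-pair i j} u | AnyP.tabulate⁻ {f = τ-pair i' j'} v
    ... | m , u' | m' , v' with ∈τ-pair i j m u' | ∈τ-pair i' j' m' v'
    ...   | inj₁ y≡ | inj₁ y≡' = i≢i' (Σ₁.fpt-block i i' m m' i<n i'<n (trans (sym y≡) y≡'))
    ...   | inj₂ y≡ | inj₂ y≡' = j≢j' (Σ₁.fpt-block j j' (mirror m) (mirror m') j<n j'<n (trans (sym y≡) y≡'))
    ...   | inj₁ y≡ | inj₂ y≡' = primes-differ (trans (sym y≡) y≡')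
    ...   | inj₂ y≡ | inj₁ y≡' = primes-differ (trans (sym y≡') y≡)

    on-blocks : ∀ {B : Set} (f g : V n → B) → (∀ i k p → i < n → f (block i k p) ≡ g (block i k p)) → ∀ y → f y ≡ g y
    on-blocks f g f≡g y with Σ₁.fpt-cover y
    ... | i , k , i<n , y≡ = subst (λ z → f z ≡ g z) (sym y≡) (f≡g i k (proj₂ y) i<n)

    σ̂ : V n → V n
    σ̂ = applyProd σ₁

    -- The relations of D₄ are checked on blocks, where σ₁ and τ act by
    -- (i , k , p) ↦ (i , next k , p) and (i , k , p) ↦ (swap i , mirror k , not p).

    σ³-on-block : ∀ i k p → i < n → σ̂ (σ̂ (σ̂ (block i k p))) ≡ block i (next (next (next k))) p
    σ³-on-block i k p i<n =
      trans (cong (λ z → σ̂ (σ̂ z)) (Σ₁.on-fpt i k p i<n))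
        (trans (cong σ̂ (Σ₁.on-fpt i (next k) p i<n)) (Σ₁.on-fpt i (next (next k)) p i<n))

    σ⁴≡id : ∀ y → σ̂ (σ̂ (σ̂ (σ̂ y))) ≡ y
    σ⁴≡id = on-blocks (λ y → σ̂ (σ̂ (σ̂ (σ̂ y)))) (λ y → y) λ i k p i<n → begin
      σ̂ (σ̂ (σ̂ (σ̂ (block i k p))))         ≡⟨ cong (λ z → σ̂ (σ̂ (σ̂ z))) (Σ₁.on-fpt i k p i<n) ⟩
      σ̂ (σ̂ (σ̂ (block i (next k) p)))      ≡⟨ σ³-on-block i (next k) p i<n ⟩
      block i (next (next (next (next k)))) p ≡⟨ cong (λ m → block i m p) (next-order4 k) ⟩
      block i k p                         ∎
      where open ≡-Reasoning

    -- τ is studied as an abstract list of cycles equal to its decomposition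
    -- into groups: unfolding the concrete list during type checking is
    -- prohibitively expensive.
    module Transpositions (τc : List Cycle) (τc≡ : τc ≡ concatMap τ-group τ-blocks) where

      τ-flips : All FlipPair τc
      τ-flips = subst (All FlipPair) (sym τc≡)
        (All-concatMap τ-group {τ-blocks} λ { (i , j) → AllP.tabulate⁺ (flip-pair i j) })
        where
        flip-pair : ∀ i j m → FlipPair (τ-pair i j m)
        flip-pair i j m = _ , _ , refl , trans (Σ₁.κ-fpt j (mirror m) true)
          (trans (classD-mirror m false) (cong (_·D s) (sym (Σ₁.κ-fpt i m false))))

      τ-disjoint : Disjoint τc
      τ-disjoint = subst Disjoint (sym τc≡)
        (disjoint-concatMap τ-group Separated τ-blocks-separated τ-group-disjoint τ-groups-apart)

      τ-pair∈τ : ∀ i m → i < n → τ-pair i (swap i) m ∈ τc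
      τ-pair∈τ i m i<n = subst (τ-pair i (swap i) m ∈_) (sym τc≡)
        (AnyP.concatMap⁺ τ-group (lose (pair∈τ-blocks i i<n) (MP.∈-tabulate⁺ {f = τ-pair i (swap i)} m)))

      τ-on-unprimed : ∀ i m → i < n → applyProd τc (block i m false) ≡ block (swap i) (mirror m) true
      τ-on-unprimed i m i<n = trans
        (FlipProduct.product-on-cycle τc (τ-pair i (swap i) m) (block i m false) τ-flips τ-disjoint (τ-pair∈τ i m i<n) (here refl))
        (cyc₂-a (block i m false) (block (swap i) (mirror m) true))

      τ-on-primed : ∀ j m → j < n → applyProd τc (block j (mirror m) true) ≡ block (swap j) m false
      τ-on-primed j m j<n = trans
        (FlipProduct.product-on-cycle τc (τ-pair (swap j) j m) (block j (mirror m) true) τ-flips τ-disjoint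
          (subst (λ i → τ-pair (swap j) i m ∈ τc) (swap-involutive j) (τ-pair∈τ (swap j) m (swap<n j<n)))
          (there (here refl)))
        (cyc₂-b (block (swap j) m false) (block j (mirror m) true) (λ e → primes-differ (sym e)))

      τ-on-block : ∀ i k p → i < n → applyProd τc (block i k p) ≡ block (swap i) (mirror k) (not p)
      τ-on-block i k false i<n = τ-on-unprimed i k i<n
      τ-on-block i k true i<n =
        trans (cong (λ m → applyProd τc (block i m true)) (sym (mirror-involutive k))) (τ-on-primed i (mirror k) i<n)

      τ-shifts : ∀ y → κ (applyProd τc y) ≡ κ y ·D s
      τ-shifts = on-blocks (λ y → κ (applyProd τc y)) (λ y → κ y ·D s) λ i k p i<n → begin
        κ (applyProd τc (block i k p))                     ≡⟨ cong κ (τ-on-block i k p i<n) ⟩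
        κ (block (swap i) (mirror k) (not p))   ≡⟨ Σ₁.κ-fpt (swap i) (mirror k) (not p) ⟩
        classD (res (mirror k)) (not p)         ≡⟨ classD-mirror k p ⟩
        classD (res k) p ·D s                   ≡⟨ cong (_·D s) (sym (Σ₁.κ-fpt i k p)) ⟩
        κ (block i k p) ·D s                    ∎
        where open ≡-Reasoning

      τ⁻¹-shifts : ∀ y → κ (applyProd (invProd τc) y) ≡ κ y ·D invD s
      τ⁻¹-shifts = equivariant-inverse τc s τ-shifts (λ y → FlipProduct.product-inverse τc y τ-flips)

      τ̂ : V n → V n
      τ̂ = applyProd τc

      τ²≡id : ∀ y → τ̂ (τ̂ y) ≡ y
      τ²≡id = on-blocks (λ y → τ̂ (τ̂ y)) (λ y → y) λ i k p i<n → begin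
        τ̂ (τ̂ (block i k p))                                     ≡⟨ cong τ̂ (τ-on-block i k p i<n) ⟩
        τ̂ (block (swap i) (mirror k) (not p))                   ≡⟨ τ-on-block (swap i) (mirror k) (not p) (swap<n i<n) ⟩
        block (swap (swap i)) (mirror (mirror k)) (not (not p)) ≡⟨ cong₂ (λ j m → block j m (not (not p))) (swap-involutive i) (mirror-involutive k) ⟩
        block i k (not (not p))                                 ≡⟨ cong (block i k) (BoolP.not-involutive p) ⟩
        block i k p                                             ∎
        where open ≡-Reasoning

      στ≡τσ³ : ∀ y → σ̂ (τ̂ y) ≡ τ̂ (σ̂ (σ̂ (σ̂ y)))
      στ≡τσ³ = on-blocks (λ y → σ̂ (τ̂ y)) (λ y → τ̂ (σ̂ (σ̂ (σ̂ y)))) λ i k p i<n → begin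
        σ̂ (τ̂ (block i k p))                              ≡⟨ cong σ̂ (τ-on-block i k p i<n) ⟩
        σ̂ (block (swap i) (mirror k) (not p))            ≡⟨ Σ₁.on-fpt (swap i) (mirror k) (not p) (swap<n i<n) ⟩
        block (swap i) (next (mirror k)) (not p)         ≡⟨ cong (λ m → block (swap i) m (not p)) (next-mirror k) ⟩
        block (swap i) (mirror (next (next (next k)))) (not p) ≡⟨ sym (τ-on-block i (next (next (next k))) p i<n) ⟩
        τ̂ (block i (next (next (next k))) p)             ≡⟨ cong τ̂ (sym (σ³-on-block i k p i<n)) ⟩
        τ̂ (σ̂ (σ̂ (σ̂ (block i k p))))                    ∎
        where open ≡-Reasoning

    -- instantiated at gen 2 (which is τ), so that the statements below match
    -- the generator-indexed statements syntactically
    open Transpositions (gen (Fin.suc (Fin.suc Fin.zero))) τ-family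

    σ₂-shifts : ∀ y → κ (applyProd σ₂ y) ≡ κ y ·D r
    σ₂-shifts y rewrite σ₂-family = Σ₂.shifts y

    σ₂-inverse : ∀ y → applyProd σ₂ (applyProd (invProd σ₂) y) ≡ y
    σ₂-inverse y rewrite σ₂-family = Σ₂.inverse y

    gen-shifts : ∀ g y → κ (applyProd (gen g) y) ≡ κ y ·D genD g
    gen-shifts Fin.zero = Σ₁.shifts
    gen-shifts (Fin.suc Fin.zero) = σ₂-shifts
    gen-shifts (Fin.suc (Fin.suc Fin.zero)) y = τ-shifts y

    equivariant : ∀ ℓ y → κ (letter ℓ y) ≡ κ y ·D letterD ℓ
    equivariant (g , false) = gen-shifts g
    equivariant (Fin.zero , true) = equivariant-inverse σ₁ r Σ₁.shifts Σ₁.inverse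
    equivariant (Fin.suc Fin.zero , true) = equivariant-inverse σ₂ r σ₂-shifts σ₂-inverse
    equivariant (Fin.suc (Fin.suc Fin.zero) , true) y = τ⁻¹-shifts y

    -- the criterion applies, with x₀ the point labelled 1 (class 1, named eD)
    semidirect : SemidirectΛD4
    semidirect = Criterion.semidirect equivariant σ̂ τ̂ (λ _ → refl) (λ _ → refl) σ⁴≡id τ²≡id στ≡τσ³
      (block 0 Fin.zero false) (Σ₁.κ-fpt 0 Fin.zero false)

-- The theorem: n is positive as a prime, and 2 ≤ t ≤ n − 2 gives 1 < n,
-- t < n and t ≠ 1.
lemma5p2 : (b c : ℤ) (n : ℕ) → ℤ.+ n ≡ b ℤ.* b ℤ.+ c ℤ.* c → (p : Prime n) →
    Chiral44 b c → (t : ℕ) → 2 ≤ t → t ≤ n ∸ 2 → n ∣ t * t + 1 →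
    (t % 4 ≡ 0 ⊎ t % 4 ≡ 3) →
    Setup.SemidirectΛD4 n {{prime⇒nonZero p}} t
lemma5p2 _ _ n _ p _ t 2≤t t≤n∸2 _ _ =
  Development.Generators.semidirect n {{prime⇒nonZero p}} t 2≤n t<n t≢1
  where
  2≤n : 2 ≤ n
  2≤n = NP.≤-trans 2≤t (NP.≤-trans t≤n∸2 (NP.m∸n≤m n 2))
  t<n : t < n
  t<n = NP.≤-<-trans t≤n∸2 (NP.∸-monoʳ-< {o = 0} (s≤s z≤n) 2≤n)
  t≢1 : t ≢ 1
  t≢1 t≡1 = NP.<-irrefl refl (subst (2 ≤_) t≡1 2≤t)
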